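{- Let $n\ge 1$ be an integer, let $\gamma_0,\ldots,\gamma_{\lfloor n/2\rfloor}$ be formal variables, and for $0\le i\le n$ let $h_i=\sum_{j=0}^{\min(i,\lfloor n/2\rfloor)}\binom{n-2j}{i-j}\gamma_j$. For $1\le i\le n-1$ and integers $j\le k$, let $c^{(i)}_{jk}$ be the coefficient of $\gamma_j\gamma_k$ in $h_i^2-h_{i-1}h_{i+1}$ (with $c^{(i)}_{jk}=0$ if $j<0$ or $k>\lfloor n/2\rfloor$). Let $0\le i\le n/2$ and $1\le \ell\le (i+1)/2$ be integers. Then: (i) if $c^{(i)}_{\ell-j_0,\ell+j_0}<0$ for some integer $j_0\ge 0$, then $c^{(i)}_{\ell-j,\ell+j}\le 0$ for every integer $j\ge j_0$; (ii) if $c^{(i)}_{\ell-1-j_0,\ell+j_0}<0$ for some integer $j_0\ge 0$, then $c^{(i)}_{\ell-1-j,\ell+j}\le 0$ for every integer $j\ge j_0$.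
   Context: Binomial coefficients $\binom{a}{b}$ with integer $a\ge 0$ are taken to be $0$ unless $0\le b\le a$. -}

module Defs where

open import Data.Bool using (if_then_else_)
open import Data.Nat as ℕ using (ℕ; _≤ᵇ_; _≡ᵇ_; ⌊_/2⌋; _∸_)
open import Data.Nat.Combinatorics using (_C_)
open import Data.Integer using (ℤ; +_; -[1+_]; _+_; _-_; _*_)

-- Binomial coefficient binom a b for a : ℕ, b : ℤ; it is 0 unless 0 ≤ b ≤ a
-- (the library's _C_ already returns 0 when b > a).
binom : ℕ → ℤ → ℤ
binom a (+ b)    = + (a C b)
binom a -[1+ _ ] = + 0

-- Coefficient of γ_j in the linear form h_i = Σ_{j=0}^{⌊n/2⌋} C(n-2j, i-j) γ_j
-- (valid for 0 ≤ j ≤ ⌊n/2⌋, where n - 2j ≥ 0; terms with j > i vanish).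
hcoef : ℕ → ℤ → ℕ → ℤ
hcoef n i j = binom (n ∸ 2 ℕ.* j) (i - + j)

-- Coefficient of γ_j γ_k (j ≠ k counted as one monomial) in the product of
-- two linear forms with coefficient functions a and b.
prodCoef : (ℕ → ℤ) → (ℕ → ℤ) → ℕ → ℕ → ℤ
prodCoef a b j k =
  if j ≡ᵇ k then a j * b j else (a j * b k + a k * b j)

-- c n i j k = c^{(i)}_{jk}: coefficient of γ_j γ_k in h_i^2 - h_{i-1} h_{i+1},
-- set to 0 when j < 0 or k > ⌊n/2⌋ (and also when k < 0, a case with k < j).
c : ℕ → ℕ → ℤ → ℤ → ℤ
c n i (+ j) (+ k) =
  if k ≤ᵇ ⌊ n /2⌋
  then prodCoef (hcoef n (+ i)) (hcoef n (+ i)) j k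
       - prodCoef (hcoef n (+ i - + 1)) (hcoef n (+ i + + 1)) j k
  else + 0
c n i (+ j) -[1+ k ] = + 0
c n i -[1+ j ] k = + 0

module Submission where

-- Write n = 2p + x + y and i = p + x. The coefficients of γ_p in h_{i-1}, h_i, h_{i+1} are then
-- b = C(x+y, x-1), a = C(x+y, x), d = C(x+y, x+1), and b (1 + y) = a x, d (1 + x) = a y.
-- Eliminating b and d shows that, for p, q ≤ i, the coefficient c_{pq} is a non-negative multiple
-- of an explicit polynomial Φ in the coordinates (x, y) of p and (u, v) of q. Along an
-- anti-diagonal (p₀ - j, q₀ + j) with p₀ ≤ q₀ ≤ i this polynomial is decreasing in j, while once
-- q₀ + j > i the coefficient reduces to -b_p d_q ≤ 0 and once p₀ - j < 0 it is 0. So a negative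
-- value is never followed by a positive one; (i) and (ii) are the anti-diagonals with q₀ - p₀ = 0, 1.

open import Defs
open import Data.Nat using (ℕ; _≤_)
open import Data.Integer using (ℤ; +_; _+_; _-_) renaming (_<_ to _<ℤ_; _≤_ to _≤ℤ_)
open import Data.Product using (_×_; _,_)

open import Data.Bool using (true; false)
open import Data.List using ([]; _∷_)
open import Data.Nat as ℕ using (zero; suc; _<_; _⊓_; z≤n; s≤s; ⌊_/2⌋)
import Data.Nat.Properties as ℕ
open import Data.Nat.Combinatorics using (_C_; k>n⇒nCk≡0; nC1≡n; nCk+nC[k+1]≡[n+1]C[k+1])
import Data.Nat.Tactic.RingSolver as ℕ-Solver
open import Data.Integer using (-[1+_]; 0ℤ; _*_; -_; +≤+; +<+; -<+; nonNegative)
import Data.Integer.Properties as ℤ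
open import Data.Integer.Tactic.RingSolver using (solve-∀; solve)
open import Data.Sum using (inj₁; inj₂)
open import Relation.Nullary using (yes; no; contradiction)
open import Relation.Binary.PropositionalEquality

[m+n]C[1+m]*[1+m]≡[m+n]Cm*n : ∀ m n → ((m ℕ.+ n) C suc m) ℕ.* suc m ≡ ((m ℕ.+ n) C m) ℕ.* n
[m+n]C[1+m]*[1+m]≡[m+n]Cm*n m zero =
  trans (cong (ℕ._* suc m) (k>n⇒nCk≡0 (s≤s (ℕ.≤-reflexive (ℕ.+-identityʳ m)))))
        (sym (ℕ.*-zeroʳ ((m ℕ.+ 0) C m)))
[m+n]C[1+m]*[1+m]≡[m+n]Cm*n zero (suc n) =
  trans (cong (ℕ._* 1) (nC1≡n (suc n))) (trans (ℕ.*-identityʳ (suc n)) (sym (ℕ.*-identityˡ (suc n))))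
[m+n]C[1+m]*[1+m]≡[m+n]Cm*n (suc m) (suc n) = begin
  (suc K C suc (suc m)) ℕ.* suc (suc m)
    ≡⟨ cong (ℕ._* suc (suc m)) (nCk+nC[k+1]≡[n+1]C[k+1] K (suc m)) ⟨
  (β ℕ.+ γ) ℕ.* suc (suc m)
    ≡⟨ split-first β γ m ⟩
  β ℕ.* suc m ℕ.+ β ℕ.+ γ ℕ.* suc (suc m)
    ≡⟨ cong₂ (λ s t → s ℕ.+ β ℕ.+ t) ih₂ ih₁ ⟩
  α ℕ.* suc n ℕ.+ β ℕ.+ β ℕ.* n
    ≡⟨ merge α β n ⟩
  (α ℕ.+ β) ℕ.* suc n
    ≡⟨ cong (ℕ._* suc n) (nCk+nC[k+1]≡[n+1]C[k+1] K m) ⟩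
  (suc K C suc m) ℕ.* suc n ∎
  where
  open ≡-Reasoning
  K = m ℕ.+ suc n
  α = K C m
  β = K C suc m
  γ = K C suc (suc m)
  ih₁ : γ ℕ.* suc (suc m) ≡ β ℕ.* n
  ih₁ = subst (λ k → (k C suc (suc m)) ℕ.* suc (suc m) ≡ (k C suc m) ℕ.* n)
              (sym (ℕ.+-suc m n)) ([m+n]C[1+m]*[1+m]≡[m+n]Cm*n (suc m) n)
  ih₂ : β ℕ.* suc m ≡ α ℕ.* suc n
  ih₂ = [m+n]C[1+m]*[1+m]≡[m+n]Cm*n m (suc n)
  split-first : ∀ b c k → (b ℕ.+ c) ℕ.* suc (suc k) ≡ b ℕ.* suc k ℕ.+ b ℕ.+ c ℕ.* suc (suc k)
  split-first = ℕ-Solver.solve-∀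
  merge : ∀ a b k → a ℕ.* suc k ℕ.+ b ℕ.+ b ℕ.* k ≡ (a ℕ.+ b) ℕ.* suc k
  merge = ℕ-Solver.solve-∀

record BinomialRatios (x y a b d : ℤ) : Set where
  field
    pred-ratio : b * (+ 1 + y) ≡ a * x
    succ-ratio : d * (+ 1 + x) ≡ a * y

binomialRatios : ∀ x y → BinomialRatios (+ x) (+ y)
  (binom (x ℕ.+ y) (+ x)) (binom (x ℕ.+ y) (+ x - + 1)) (binom (x ℕ.+ y) (+ suc x))
binomialRatios x y = record { pred-ratio = pred-ratio x ; succ-ratio = succ-ratio x y }
  where
  succ-ratio : ∀ m n → binom (m ℕ.+ n) (+ suc m) * + suc m ≡ binom (m ℕ.+ n) (+ m) * + n
  succ-ratio m n = begin
    + ((m ℕ.+ n) C suc m) * + suc m   ≡⟨ ℤ.pos-* ((m ℕ.+ n) C suc m) (suc m) ⟨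
    + (((m ℕ.+ n) C suc m) ℕ.* suc m) ≡⟨ cong +_ ([m+n]C[1+m]*[1+m]≡[m+n]Cm*n m n) ⟩
    + (((m ℕ.+ n) C m) ℕ.* n)         ≡⟨ ℤ.pos-* ((m ℕ.+ n) C m) n ⟩
    + ((m ℕ.+ n) C m) * + n           ∎
    where open ≡-Reasoning
  pred-ratio : ∀ x → binom (x ℕ.+ y) (+ x - + 1) * + suc y ≡ binom (x ℕ.+ y) (+ x) * + x
  pred-ratio zero    = sym (ℤ.*-zeroʳ (binom y (+ 0)))
  pred-ratio (suc x) = subst (λ k → binom k (+ x) * + suc y ≡ binom k (+ suc x) * + suc x)
                             (ℕ.+-suc x y) (sym (succ-ratio x (suc y)))

binom-nonNeg : ∀ m k → 0ℤ ≤ℤ binom m k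
binom-nonNeg m (+ _)    = +≤+ z≤n
binom-nonNeg m -[1+ _ ] = +≤+ z≤n

binom-neg : ∀ m {k} → k <ℤ 0ℤ → binom m k ≡ 0ℤ
binom-neg m { -[1+ _ ]} _ = refl
binom-neg m {+ _} (+<+ ())

[i+j]-i≡j : ∀ i j → i + j - i ≡ j
[i+j]-i≡j = solve-∀

[i+j+k]-i≡j+k : ∀ i j k → i + j + k - i ≡ j + k
[i+j+k]-i≡j+k = solve-∀

[i+j+1]-i≡1+j : ∀ i j → i + j + + 1 - i ≡ + 1 + j
[i+j+1]-i≡1+j = solve-∀

i<j⇒i-j<0 : ∀ {i j} → i <ℤ j → i - j <ℤ 0ℤ
i<j⇒i-j<0 {j = j} i<j = ℤ.<-≤-trans (ℤ.+-monoˡ-< (- j) i<j) (ℤ.≤-reflexive (ℤ.+-inverseʳ j))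

*-nonNeg : ∀ {i j} → 0ℤ ≤ℤ i → 0ℤ ≤ℤ j → 0ℤ ≤ℤ i * j
*-nonNeg {+ m} {+ n} _ _ = subst (0ℤ ≤ℤ_) (ℤ.pos-* m n) (+≤+ z≤n)

hcoef-central : ∀ {n i p} x y → n ≡ 2 ℕ.* p ℕ.+ (x ℕ.+ y) → i ≡ p ℕ.+ x →
  hcoef n (+ i) p ≡ + ((x ℕ.+ y) C x)
hcoef-central {p = p} x y refl refl
  rewrite ℕ.m+n∸m≡n (2 ℕ.* p) (x ℕ.+ y) | [i+j]-i≡j (+ p) (+ x) = refl

hcoef-ratios : ∀ {n i p} x y → n ≡ 2 ℕ.* p ℕ.+ (x ℕ.+ y) → i ≡ p ℕ.+ x →
  BinomialRatios (+ x) (+ y) (hcoef n (+ i) p) (hcoef n (+ i - + 1) p) (hcoef n (+ i + + 1) p)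
hcoef-ratios {p = p} x y refl refl
  rewrite ℕ.m+n∸m≡n (2 ℕ.* p) (x ℕ.+ y)
        | [i+j]-i≡j (+ p) (+ x) | [i+j+k]-i≡j+k (+ p) (+ x) (- + 1) | [i+j+1]-i≡1+j (+ p) (+ x)
  = binomialRatios x y

prodCoef-diag : ∀ f g p → prodCoef f g p p ≡ f p * g p
prodCoef-diag f g p with p ℕ.≡ᵇ p | ℕ.≡⇒≡ᵇ p p refl
... | true | _ = refl

prodCoef-offDiag : ∀ f g {p q} → p ≢ q → prodCoef f g p q ≡ f p * g q + f q * g p
prodCoef-offDiag f g {p} {q} p≢q with p ℕ.≡ᵇ q | ℕ.≡ᵇ⇒≡ p q
... | false | _ = refl
... | true | ≡ᵇ⇒≡ = contradiction (≡ᵇ⇒≡ _) p≢q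

n≤⌊2n+m/2⌋ : ∀ n m → n ≤ ⌊ 2 ℕ.* n ℕ.+ m /2⌋
n≤⌊2n+m/2⌋ n m = ℕ.≤-trans (ℕ.≤-reflexive (ℕ.n≡⌊n+n/2⌋ n)) (ℕ.⌊n/2⌋-mono n+n≤2n+m)
  where
  n+n≤2n+m : n ℕ.+ n ≤ 2 ℕ.* n ℕ.+ m
  n+n≤2n+m = subst (λ k → n ℕ.+ k ≤ 2 ℕ.* n ℕ.+ m) (ℕ.+-identityʳ n) (ℕ.m≤m+n (2 ℕ.* n) m)

c-unfold : ∀ n i p q → q ≤ ⌊ n /2⌋ → c n i (+ p) (+ q) ≡
  prodCoef (hcoef n (+ i)) (hcoef n (+ i)) p q - prodCoef (hcoef n (+ i - + 1)) (hcoef n (+ i + + 1)) p q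
c-unfold n i p q q≤n/2 with q ℕ.≤ᵇ ⌊ n /2⌋ | ℕ.≤⇒≤ᵇ q≤n/2
... | true | _ = refl

c-negˡ : ∀ {n i k l} → k <ℤ 0ℤ → c n i k l ≡ 0ℤ
c-negˡ {k = -[1+ _ ]} _ = refl
c-negˡ {k = + _} (+<+ ())

-- With b = a x / (1 + y) and d = a y / (1 + x) as in BinomialRatios, the quantity
-- 2 a a' - (b d' + b' d) equals a a' Φ x y u v / ((1 + x) (1 + y) (1 + u) (1 + v)).
Φ : ℤ → ℤ → ℤ → ℤ → ℤ
Φ x y u v = + 2 * ((+ 1 + x) * (+ 1 + y) * (+ 1 + u) * (+ 1 + v))
          - x * (+ 1 + x) * v * (+ 1 + v) - u * (+ 1 + u) * y * (+ 1 + y)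

Φ-scaling : ∀ {x y u v a b d a′ b′ d′} → BinomialRatios x y a b d → BinomialRatios u v a′ b′ d′ →
  ((a * a′ + a′ * a) - (b * d′ + b′ * d)) * ((+ 1 + x) * (+ 1 + y) * (+ 1 + u) * (+ 1 + v))
    ≡ a * a′ * Φ x y u v
Φ-scaling {x} {y} {u} {v} {a} {b} {d} {a′} {b′} {d′} r r′ = begin
  ((a * a′ + a′ * a) - (b * d′ + b′ * d)) * ((+ 1 + x) * (+ 1 + y) * (+ 1 + u) * (+ 1 + v))
    ≡⟨ solve (x ∷ y ∷ u ∷ v ∷ a ∷ b ∷ d ∷ a′ ∷ b′ ∷ d′ ∷ []) ⟩
  + 2 * (a * a′) * ((+ 1 + x) * (+ 1 + y) * (+ 1 + u) * (+ 1 + v))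
    - (b * (+ 1 + y)) * (d′ * (+ 1 + u)) * ((+ 1 + x) * (+ 1 + v))
    - (b′ * (+ 1 + v)) * (d * (+ 1 + x)) * ((+ 1 + y) * (+ 1 + u))
    ≡⟨ cong₂ (λ s t → + 2 * (a * a′) * ((+ 1 + x) * (+ 1 + y) * (+ 1 + u) * (+ 1 + v))
                        - s * ((+ 1 + x) * (+ 1 + v)) - t * ((+ 1 + y) * (+ 1 + u)))
             (cong₂ _*_ (pred-ratio r) (succ-ratio r′)) (cong₂ _*_ (pred-ratio r′) (succ-ratio r)) ⟩
  + 2 * (a * a′) * ((+ 1 + x) * (+ 1 + y) * (+ 1 + u) * (+ 1 + v))
    - (a * x) * (a′ * v) * ((+ 1 + x) * (+ 1 + v))
    - (a′ * u) * (a * y) * ((+ 1 + y) * (+ 1 + u))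
    ≡⟨ solve (x ∷ y ∷ u ∷ v ∷ a ∷ a′ ∷ []) ⟩
  a * a′ * (+ 2 * ((+ 1 + x) * (+ 1 + y) * (+ 1 + u) * (+ 1 + v))
            - x * (+ 1 + x) * v * (+ 1 + v) - u * (+ 1 + u) * y * (+ 1 + y)) ∎
  where
  open ≡-Reasoning
  open BinomialRatios

infix 4 _∝_
record _∝_ (a b : ℤ) : Set where
  constructor scaling
  field
    denominator weight : ℕ
    scaled : a * + suc denominator ≡ + weight * b

∝-nonPos : ∀ {a b} → a ∝ b → b ≤ℤ 0ℤ → a ≤ℤ 0ℤ
∝-nonPos {a} {b} (scaling k w eq) b≤0 = ℤ.*-cancelʳ-≤-pos a 0ℤ (+ suc k) (begin
  a * + suc k   ≡⟨ eq ⟩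
  + w * b       ≤⟨ ℤ.*-monoˡ-≤-nonNeg (+ w) b≤0 ⟩
  + w * 0ℤ      ≡⟨ ℤ.*-zeroʳ (+ w) ⟩
  0ℤ            ∎)
  where open ℤ.≤-Reasoning

∝-neg : ∀ {a b} → a ∝ b → a <ℤ 0ℤ → b <ℤ 0ℤ
∝-neg {b = -[1+ _ ]} _ _ = -<+
∝-neg {a} {+ m} (scaling k w eq) a<0 = contradiction a≥0 (ℤ.<⇒≱ a<0)
  where
  a≥0 : 0ℤ ≤ℤ a
  a≥0 = ℤ.*-cancelʳ-≤-pos 0ℤ a (+ suc k)
          (subst (0ℤ ≤ℤ_) (sym eq) (*-nonNeg {+ w} {+ m} (+≤+ z≤n) (+≤+ z≤n)))

module _ {n i : ℕ} where
  private
    H H⁻ H⁺ : ℕ → ℤ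
    H  = hcoef n (+ i)
    H⁻ = hcoef n (+ i - + 1)
    H⁺ = hcoef n (+ i + + 1)

  c-offDiag-∝-Φ : ∀ {p q} x y u v → p ≢ q →
    n ≡ 2 ℕ.* p ℕ.+ (x ℕ.+ y) → i ≡ p ℕ.+ x → n ≡ 2 ℕ.* q ℕ.+ (u ℕ.+ v) → i ≡ q ℕ.+ u →
    c n i (+ p) (+ q) ∝ Φ (+ x) (+ y) (+ u) (+ v)
  c-offDiag-∝-Φ {p} {q} x y u v p≢q n≡ₚ i≡ₚ n≡q i≡q =
    scaling _ (((x ℕ.+ y) C x) ℕ.* ((u ℕ.+ v) C u)) (begin
      c n i (+ p) (+ q) * ((+ 1 + + x) * (+ 1 + + y) * (+ 1 + + u) * (+ 1 + + v))
        ≡⟨ cong (_* ((+ 1 + + x) * (+ 1 + + y) * (+ 1 + + u) * (+ 1 + + v))) c≡ ⟩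
      ((H p * H q + H q * H p) - (H⁻ p * H⁺ q + H⁻ q * H⁺ p))
        * ((+ 1 + + x) * (+ 1 + + y) * (+ 1 + + u) * (+ 1 + + v))
        ≡⟨ Φ-scaling (hcoef-ratios x y n≡ₚ i≡ₚ) (hcoef-ratios u v n≡q i≡q) ⟩
      H p * H q * Φ (+ x) (+ y) (+ u) (+ v)
        ≡⟨ cong₂ (λ s t → s * t * Φ (+ x) (+ y) (+ u) (+ v))
                 (hcoef-central x y n≡ₚ i≡ₚ) (hcoef-central u v n≡q i≡q) ⟩
      + ((x ℕ.+ y) C x) * + ((u ℕ.+ v) C u) * Φ (+ x) (+ y) (+ u) (+ v)
        ≡⟨ cong (_* Φ (+ x) (+ y) (+ u) (+ v)) (ℤ.pos-* ((x ℕ.+ y) C x) ((u ℕ.+ v) C u)) ⟨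
      + (((x ℕ.+ y) C x) ℕ.* ((u ℕ.+ v) C u)) * Φ (+ x) (+ y) (+ u) (+ v) ∎)
    where
    open ≡-Reasoning
    c≡ : c n i (+ p) (+ q) ≡ (H p * H q + H q * H p) - (H⁻ p * H⁺ q + H⁻ q * H⁺ p)
    c≡ = trans (c-unfold n i p q (subst (λ m → q ≤ ⌊ m /2⌋) (sym n≡q) (n≤⌊2n+m/2⌋ q (u ℕ.+ v))))
               (cong₂ _-_ (prodCoef-offDiag H H p≢q) (prodCoef-offDiag H⁻ H⁺ p≢q))

  c-diag-∝-Φ : ∀ {p} x y → n ≡ 2 ℕ.* p ℕ.+ (x ℕ.+ y) → i ≡ p ℕ.+ x →
    c n i (+ p) (+ p) ∝ Φ (+ x) (+ y) (+ x) (+ y)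
  c-diag-∝-Φ {p} x y n≡ i≡ =
    scaling _ (((x ℕ.+ y) C x) ℕ.* ((x ℕ.+ y) C x)) (begin
      c n i (+ p) (+ p) * (+ 2 * D)
        ≡⟨ cong (_* (+ 2 * D)) c≡ ⟩
      (H p * H p - H⁻ p * H⁺ p) * (+ 2 * D)
        ≡⟨ double (H p) (H⁻ p) (H⁺ p) D ⟩
      ((H p * H p + H p * H p) - (H⁻ p * H⁺ p + H⁻ p * H⁺ p)) * D
        ≡⟨ Φ-scaling r r ⟩
      H p * H p * Φ (+ x) (+ y) (+ x) (+ y)
        ≡⟨ cong (λ s → s * s * Φ (+ x) (+ y) (+ x) (+ y)) (hcoef-central x y n≡ i≡) ⟩
      + ((x ℕ.+ y) C x) * + ((x ℕ.+ y) C x) * Φ (+ x) (+ y) (+ x) (+ y)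
        ≡⟨ cong (_* Φ (+ x) (+ y) (+ x) (+ y)) (ℤ.pos-* ((x ℕ.+ y) C x) ((x ℕ.+ y) C x)) ⟨
      + (((x ℕ.+ y) C x) ℕ.* ((x ℕ.+ y) C x)) * Φ (+ x) (+ y) (+ x) (+ y) ∎)
    where
    open ≡-Reasoning
    D : ℤ
    D = (+ 1 + + x) * (+ 1 + + y) * (+ 1 + + x) * (+ 1 + + y)
    r = hcoef-ratios x y n≡ i≡
    c≡ : c n i (+ p) (+ p) ≡ H p * H p - H⁻ p * H⁺ p
    c≡ = trans (c-unfold n i p p (subst (λ m → p ≤ ⌊ m /2⌋) (sym n≡) (n≤⌊2n+m/2⌋ p (x ℕ.+ y))))
               (cong₂ _-_ (prodCoef-diag H H p) (prodCoef-diag H⁻ H⁺ p))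
    double : ∀ a b d D → (a * a - b * d) * (+ 2 * D) ≡ ((a * a + a * a) - (b * d + b * d)) * D
    double = solve-∀

  c-nonPos-beyond : ∀ k q → k ≤ℤ + i → i < q → c n i k (+ q) ≤ℤ 0ℤ
  c-nonPos-beyond -[1+ _ ] q _ _ = ℤ.≤-refl
  c-nonPos-beyond (+ p) q (+≤+ p≤i) i<q with q ℕ.≤ᵇ ⌊ n /2⌋
  ... | false = ℤ.≤-refl
  ... | true = begin
    prodCoef H H p q - prodCoef H⁻ H⁺ p q
      ≡⟨ cong₂ _-_ (prodCoef-offDiag H H p≢q) (prodCoef-offDiag H⁻ H⁺ p≢q) ⟩
    (H p * H q + H q * H p) - (H⁻ p * H⁺ q + H⁻ q * H⁺ p)
      ≡⟨ cong₂ (λ s t → (H p * s + s * H p) - (H⁻ p * H⁺ q + t * H⁺ p)) Hq≡0 H⁻q≡0 ⟩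
    (H p * 0ℤ + 0ℤ * H p) - (H⁻ p * H⁺ q + 0ℤ * H⁺ p)
      ≡⟨ simplify (H p) (H⁻ p) (H⁺ q) (H⁺ p) ⟩
    - (H⁻ p * H⁺ q)
      ≤⟨ ℤ.neg-mono-≤ (*-nonNeg {H⁻ p} {H⁺ q} (binom-nonNeg _ _) (binom-nonNeg _ _)) ⟩
    0ℤ ∎
    where
    open ℤ.≤-Reasoning
    p≢q : p ≢ q
    p≢q refl = ℕ.<-irrefl refl (ℕ.≤-<-trans p≤i i<q)
    Hq≡0 : H q ≡ 0ℤ
    Hq≡0 = binom-neg _ (i<j⇒i-j<0 (+<+ i<q))
    H⁻q≡0 : H⁻ q ≡ 0ℤ
    H⁻q≡0 = binom-neg _ (i<j⇒i-j<0 (ℤ.≤-<-trans (ℤ.i-j≤i (+ i) (+ 1)) (+<+ i<q)))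
    simplify : ∀ a b d d′ → (a * 0ℤ + 0ℤ * a) - (b * d + 0ℤ * d′) ≡ - (b * d)
    simplify = solve-∀

c-∝-Φ : ∀ {n i} p x y q u v → n ≡ 2 ℕ.* p ℕ.+ (x ℕ.+ y) → i ≡ p ℕ.+ x
                            → n ≡ 2 ℕ.* q ℕ.+ (u ℕ.+ v) → i ≡ q ℕ.+ u →
  c n i (+ p) (+ q) ∝ Φ (+ x) (+ y) (+ u) (+ v)
c-∝-Φ p x y q u v n≡ₚ i≡ₚ n≡q i≡q with p ℕ.≟ q
... | no p≢q = c-offDiag-∝-Φ x y u v p≢q n≡ₚ i≡ₚ n≡q i≡q
... | yes refl with ℕ.+-cancelˡ-≡ p x u (trans (sym i≡ₚ) i≡q)
... | refl with ℕ.+-cancelˡ-≡ x y v (ℕ.+-cancelˡ-≡ (2 ℕ.* p) _ _ (trans (sym n≡ₚ) n≡q))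
... | refl = c-diag-∝-Φ x y n≡ₚ i≡ₚ

-- Φ at the coordinates of the pair (p₀ - j, q₀ + j), where q₀ = p₀ + g, i = q₀ + A and n = 2 i + e.
Ψ : ℤ → ℤ → ℤ → ℤ → ℤ
Ψ g A e j = Φ (A + g + j) (A + g + e + j) (A - j) (A + e - j)

Ψ-decrement : ℤ → ℤ → ℤ → ℤ → ℤ
Ψ-decrement g A e j = (j + j + + 1 + g) * ((A + A + e + + 1 + g) + (A + A + e + + 1 + g) + (e + e + e + e) * e)

Ψ-step : ∀ g A e j → Ψ g A e j ≡ Ψ g A e (+ 1 + j) + Ψ-decrement g A e j
Ψ-step = expanded
  where
  expanded : ∀ g A e j →
    let φ : ℤ → ℤ → ℤ → ℤ → ℤ
        φ x y u v = + 2 * ((+ 1 + x) * (+ 1 + y) * (+ 1 + u) * (+ 1 + v))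
                  - x * (+ 1 + x) * v * (+ 1 + v) - u * (+ 1 + u) * y * (+ 1 + y)
        j′ = + 1 + j
    in φ (A + g + j) (A + g + e + j) (A - j) (A + e - j)
       ≡ φ (A + g + j′) (A + g + e + j′) (A - j′) (A + e - j′)
         + (j + j + + 1 + g) * ((A + A + e + + 1 + g) + (A + A + e + + 1 + g) + (e + e + e + e) * e)
  expanded = solve-∀

Ψ-antitone : ∀ g A e j → Ψ (+ g) (+ A) (+ e) (+ suc j) ≤ℤ Ψ (+ g) (+ A) (+ e) (+ j)
Ψ-antitone g A e j =
  subst (Ψ (+ g) (+ A) (+ e) (+ suc j) ≤ℤ_) (sym (Ψ-step (+ g) (+ A) (+ e) (+ j)))
        (ℤ.i≤i+j _ _ {{nonNegative decrement≥0}})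
  where
  E W : ℤ
  E = + e + + e + + e + + e
  W = + A + + A + + e + + 1 + + g
  decrement≥0 : 0ℤ ≤ℤ Ψ-decrement (+ g) (+ A) (+ e) (+ j)
  decrement≥0 = *-nonNeg {+ j + + j + + 1 + + g} {W + W + E * + e} (+≤+ z≤n)
                  (ℤ.+-mono-≤ {0ℤ} {W + W} (+≤+ z≤n) (*-nonNeg {E} {+ e} (+≤+ z≤n) (+≤+ z≤n)))

c-antidiagonal-∝-Ψ : ∀ {p₀ g A e j} → j ≤ p₀ → j ≤ A →
  c (2 ℕ.* (p₀ ℕ.+ g ℕ.+ A) ℕ.+ e) (p₀ ℕ.+ g ℕ.+ A) (+ p₀ - + j) (+ (p₀ ℕ.+ g) + + j)
    ∝ Ψ (+ g) (+ A) (+ e) (+ j)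
c-antidiagonal-∝-Ψ {g = g} {e = e} {j} j≤p₀ j≤A
  with ℕ.m≤n⇒∃[o]m+o≡n j≤p₀ | ℕ.m≤n⇒∃[o]m+o≡n j≤A
... | s , refl | t , refl
  rewrite [i+j]-i≡j (+ j) (+ s) | [i+j]-i≡j (+ j) (+ t) | [i+j+k]-i≡j+k (+ j) (+ t) (+ e)
  = c-∝-Φ s (j ℕ.+ t ℕ.+ g ℕ.+ j) (j ℕ.+ t ℕ.+ g ℕ.+ e ℕ.+ j) (j ℕ.+ s ℕ.+ g ℕ.+ j) t (t ℕ.+ e)
      (n-p g j s t e) (i-p g j s t) (n-q g j s t e) (i-q g j s t)
  where
  n-p : ∀ g j s t e → 2 ℕ.* ((j ℕ.+ s ℕ.+ g) ℕ.+ (j ℕ.+ t)) ℕ.+ e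
                    ≡ 2 ℕ.* s ℕ.+ ((j ℕ.+ t ℕ.+ g ℕ.+ j) ℕ.+ (j ℕ.+ t ℕ.+ g ℕ.+ e ℕ.+ j))
  n-p = ℕ-Solver.solve-∀
  i-p : ∀ g j s t → (j ℕ.+ s ℕ.+ g) ℕ.+ (j ℕ.+ t) ≡ s ℕ.+ (j ℕ.+ t ℕ.+ g ℕ.+ j)
  i-p = ℕ-Solver.solve-∀
  n-q : ∀ g j s t e → 2 ℕ.* ((j ℕ.+ s ℕ.+ g) ℕ.+ (j ℕ.+ t)) ℕ.+ e
                    ≡ 2 ℕ.* ((j ℕ.+ s ℕ.+ g) ℕ.+ j) ℕ.+ (t ℕ.+ (t ℕ.+ e))
  n-q = ℕ-Solver.solve-∀
  i-q : ∀ g j s t → (j ℕ.+ s ℕ.+ g) ℕ.+ (j ℕ.+ t) ≡ (j ℕ.+ s ℕ.+ g) ℕ.+ j ℕ.+ t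
  i-q = ℕ-Solver.solve-∀

StaysNonPositive : (ℕ → ℤ) → Set
StaysNonPositive f = ∀ j₀ → f j₀ <ℤ 0ℤ → ∀ j → j₀ ≤ j → f j ≤ℤ 0ℤ

antitone : ∀ {g : ℕ → ℤ} → (∀ j → g (suc j) ≤ℤ g j) → ∀ {j₀ j} → j₀ ≤ j → g j ≤ℤ g j₀
antitone {g} step j₀≤j = go (ℕ.≤⇒≤′ j₀≤j)
  where
  go : ∀ {j₀ j} → j₀ ℕ.≤′ j → g j ≤ℤ g j₀
  go ℕ.≤′-refl         = ℤ.≤-refl
  go (ℕ.≤′-step {j} p) = ℤ.≤-trans (step j) (go p)

∝-antitone⇒staysNonPositive : ∀ {f g : ℕ → ℤ} B → (∀ j → j ≤ B → f j ∝ g j) →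
  (∀ j → B < j → f j ≤ℤ 0ℤ) → (∀ j → g (suc j) ≤ℤ g j) → StaysNonPositive f
∝-antitone⇒staysNonPositive B f∝g beyond step j₀ fj₀<0 j j₀≤j with j ℕ.≤? B
... | no j≰B = beyond j (ℕ.≰⇒> j≰B)
... | yes j≤B = ∝-nonPos (f∝g j j≤B) (ℤ.<⇒≤ (ℤ.≤-<-trans (antitone step j₀≤j) gj₀<0))
  where
  gj₀<0 = ∝-neg (f∝g j₀ (ℕ.≤-trans j₀≤j j≤B)) fj₀<0

antidiagonal-staysNonPositive : ∀ {n i p₀ q₀} → p₀ ≤ q₀ → q₀ ≤ i → 2 ℕ.* i ≤ n →
  StaysNonPositive (λ j → c n i (+ p₀ - + j) (+ q₀ + + j))
antidiagonal-staysNonPositive {p₀ = p₀} p₀≤q₀ q₀≤i 2i≤n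
  with ℕ.m≤n⇒∃[o]m+o≡n p₀≤q₀
... | g , refl with ℕ.m≤n⇒∃[o]m+o≡n q₀≤i
... | A , refl with ℕ.m≤n⇒∃[o]m+o≡n 2i≤n
... | e , refl =
  ∝-antitone⇒staysNonPositive (p₀ ⊓ A) model beyond (Ψ-antitone g A e)
  where
  f : ℕ → ℤ
  f j = c (2 ℕ.* (p₀ ℕ.+ g ℕ.+ A) ℕ.+ e) (p₀ ℕ.+ g ℕ.+ A) (+ p₀ - + j) (+ (p₀ ℕ.+ g) + + j)
  model : ∀ j → j ≤ p₀ ⊓ A → f j ∝ Ψ (+ g) (+ A) (+ e) (+ j)
  model j j≤B = c-antidiagonal-∝-Ψ (ℕ.m≤n⊓o⇒m≤n p₀ A j≤B) (ℕ.m≤n⊓o⇒m≤o p₀ A j≤B)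
  beyond : ∀ j → p₀ ⊓ A < j → f j ≤ℤ 0ℤ
  beyond j B<j with ℕ.⊓-sel p₀ A
  ... | inj₁ B≡p₀ = ℤ.≤-reflexive (c-negˡ (i<j⇒i-j<0 (+<+ (subst (_< j) B≡p₀ B<j))))
  ... | inj₂ B≡A  = c-nonPos-beyond _ _ (ℤ.≤-trans (ℤ.i-j≤i (+ p₀) (+ j)) (+≤+ p₀≤i))
                      (ℕ.+-monoʳ-< (p₀ ℕ.+ g) (subst (_< j) B≡A B<j))
    where
    p₀≤i : p₀ ≤ p₀ ℕ.+ g ℕ.+ A
    p₀≤i = ℕ.≤-trans (ℕ.m≤m+n p₀ g) (ℕ.m≤m+n (p₀ ℕ.+ g) A)

1≤m⇒2m≤n+1⇒m≤n : ∀ {m n} → 1 ≤ m → 2 ℕ.* m ≤ n ℕ.+ 1 → m ≤ n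
1≤m⇒2m≤n+1⇒m≤n {m} {n} 1≤m 2m≤n+1 =
  ℕ.+-cancelʳ-≤ 1 m n (ℕ.≤-trans (ℕ.+-monoʳ-≤ m (ℕ.≤-trans 1≤m (ℕ.m≤m+n m 0))) 2m≤n+1)

lemma3p3 : (n : ℕ) → 1 ≤ n → (i ℓ : ℕ) → 2 Data.Nat.* i ≤ n → 1 ≤ ℓ → 2 Data.Nat.* ℓ ≤ i Data.Nat.+ 1 →
    ((j₀ : ℕ) → c n i (+ ℓ - + j₀) (+ ℓ + + j₀) <ℤ + 0 →
      (j : ℕ) → j₀ ≤ j → c n i (+ ℓ - + j) (+ ℓ + + j) ≤ℤ + 0)
    × ((j₀ : ℕ) → c n i (+ ℓ - + 1 - + j₀) (+ ℓ + + j₀) <ℤ + 0 →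
      (j : ℕ) → j₀ ≤ j → c n i (+ ℓ - + 1 - + j) (+ ℓ + + j) ≤ℤ + 0)
lemma3p3 n _ i (suc ℓ′) 2i≤n 1≤ℓ 2ℓ≤i+1 =
  antidiagonal-staysNonPositive ℕ.≤-refl ℓ≤i 2i≤n ,
  antidiagonal-staysNonPositive (ℕ.n≤1+n ℓ′) ℓ≤i 2i≤n
  where
  ℓ≤i : suc ℓ′ ≤ i
  ℓ≤i = 1≤m⇒2m≤n+1⇒m≤n 1≤ℓ 2ℓ≤i+1
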